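{- Let $i$ be an intuitionistic propositional formula, $\varphi(x)=ST(i,x)$ and $k=r(\varphi)$. Let $\Sigma_\varphi\subseteq\Sigma'\subseteq\Sigma$, let $(M,a),(N,b)$ be pointed $\Sigma'$-models, and let $A$ be an $\langle(M,a),(N,b)\rangle_l$-asimulation. Then for all $\alpha,\beta\in\{M,N\}$, all $m\in\mathbb{N}$, all $(a'_1,\dots,a'_m,a')\in D(\alpha)^{m+1}$ and $(b'_1,\dots,b'_m,b')\in D(\beta)^{m+1}$: if $(a'_1,\dots,a'_m,a')A(b'_1,\dots,b'_m,b')$, $m+k\le l$ and $\alpha,a'\models\varphi(x)$, then $\beta,b'\models\varphi(x)$.
   Context: Formulas are formulas of classical first-order logic with identity in the vocabulary $\Sigma=\{R,P_1,P_2,\dots\}$, $R$ binary, each $P_n$ unary; $\Sigma_\varphi=\{R\}\cup\{P_i: P_i\text{ occurs in }\varphi\}$. The degree $r(\varphi)$ is the quantifier depth: $r=0$ for atomic, $r(\neg\varphi)=r(\varphi)$, $r(\varphi\circ\psi)=\max(r(\varphi),r(\psi))$, $r(Qx\varphi)=r(\varphi)+1$. A pointed model is $(M,a)$ with $a\in D(M)$; $M,a\models\varphi(x)$ means $\varphi$ holds in $M$ under assignments sending $x$ to $a$. Intuitionistic propositional formulas are built from $p_n$, $\bot$ with $\wedge,\vee,\to$. Standard $x$-translation: $ST(p_n,x)=P_n(x)$; $ST(\bot,x)=(x\neq x)$; $ST(i\wedge j,x)=ST(i,x)\wedge ST(j,x)$; $ST(i\vee j,x)=ST(i,x)\vee ST(j,x)$;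 $ST(i\to j,x)=\forall y(R(x,y)\to(ST(i,y)\to ST(j,y)))$, $y$ fresh. $l$-asimulation: for $R\in\Sigma'\subseteq\Sigma$ and pointed $\Sigma'$-models $(M,a),(N,b)$, a relation $A\subseteq\bigcup_{n>0}((D(M)^n\times D(N)^n)\cup(D(N)^n\times D(M)^n))$ is an $\langle(M,a),(N,b)\rangle_l$-asimulation iff $(a)A(b)$ and for all $\alpha,\beta\in\{M,N\}$, $(a'_1,\dots,a'_m,a')\in D(\alpha)^{m+1}$, $(b'_1,\dots,b'_m,b')\in D(\beta)^{m+1}$ with $(a'_1,\dots,a'_m,a')A(b'_1,\dots,b'_m,b')$: (1) for every unary $P\in\Sigma'$, $\alpha,a'\models P(x)$ implies $\beta,b'\models P(x)$; (2) if $b''\in D(\beta)$, $b'R^\beta b''$ and $m<l$, then some $a''\in D(\alpha)$ has $a'R^\alpha a''$, $(b'_1,\dots,b'_m,b',b'')A(a'_1,\dots,a'_m,a',a'')$ and $(a'_1,\dots,a'_m,a',a'')A(b'_1,\dots,b'_m,b',b'')$. -}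

module Defs where

open import Data.Nat using (ℕ; zero; suc; _⊔_; _<_; _≟_)
open import Data.Vec using (Vec; []; _∷ʳ_)
open import Data.Product using (Σ; _×_; _,_)
open import Data.Sum using (_⊎_)
open import Data.Empty using (⊥)
open import Relation.Nullary using (¬_; yes; no)
open import Relation.Binary.PropositionalEquality using (_≡_)

Var : Set
Var = ℕ

infixr 6 _∧'_
infixr 5 _∨'_
infixr 4 _⇒'_

data Fm : Set where
  R'    : Var → Var → Fm
  P'    : ℕ → Var → Fm
  _≐_   : Var → Var → Fm
  ¬'_   : Fm → Fm
  _∧'_  : Fm → Fm → Fm
  _∨'_  : Fm → Fm → Fm
  _⇒'_  : Fm → Fm → Fm
  ∀'    : Var → Fm → Fm
  ∃'    : Var → Fm → Fm

r : Fm → ℕ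
r (R' x y)   = 0
r (P' n x)   = 0
r (x ≐ y)    = 0
r (¬' φ)     = r φ
r (φ ∧' ψ)   = r φ ⊔ r ψ
r (φ ∨' ψ)   = r φ ⊔ r ψ
r (φ ⇒' ψ)   = r φ ⊔ r ψ
r (∀' x φ)   = suc (r φ)
r (∃' x φ)   = suc (r φ)

data Occurs (n : ℕ) : Fm → Set where
  here  : ∀ {x} → Occurs n (P' n x)
  ¬-in  : ∀ {φ} → Occurs n φ → Occurs n (¬' φ)
  ∧-l   : ∀ {φ ψ} → Occurs n φ → Occurs n (φ ∧' ψ)
  ∧-r   : ∀ {φ ψ} → Occurs n ψ → Occurs n (φ ∧' ψ)
  ∨-l   : ∀ {φ ψ} → Occurs n φ → Occurs n (φ ∨' ψ)
  ∨-r   : ∀ {φ ψ} → Occurs n ψ → Occurs n (φ ∨' ψ)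
  ⇒-l   : ∀ {φ ψ} → Occurs n φ → Occurs n (φ ⇒' ψ)
  ⇒-r   : ∀ {φ ψ} → Occurs n ψ → Occurs n (φ ⇒' ψ)
  ∀-in  : ∀ {x φ} → Occurs n φ → Occurs n (∀' x φ)
  ∃-in  : ∀ {x φ} → Occurs n φ → Occurs n (∃' x φ)

-- A signature Σ' with R ∈ Σ' is given by the set of indices n with P_n ∈ Σ'.
Sig : Set₁
Sig = ℕ → Set

SigIncl : Fm → Sig → Set
SigIncl φ Σ' = ∀ n → Occurs n φ → Σ' n

record Structure : Set₁ where
  field
    D   : Set
    Rel : D → D → Set
    Pr  : ℕ → D → Set
open Structure public

_[_↦_] : {D : Set} → (Var → D) → Var → D → (Var → D)
(ρ [ x ↦ d ]) y with y ≟ x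
... | yes _ = d
... | no  _ = ρ y

Sat : (M : Structure) → (Var → D M) → Fm → Set
Sat M ρ (R' x y)  = Rel M (ρ x) (ρ y)
Sat M ρ (P' n x)  = Pr M n (ρ x)
Sat M ρ (x ≐ y)   = ρ x ≡ ρ y
Sat M ρ (¬' φ)    = ¬ Sat M ρ φ
Sat M ρ (φ ∧' ψ)  = Sat M ρ φ × Sat M ρ ψ
Sat M ρ (φ ∨' ψ)  = Sat M ρ φ ⊎ Sat M ρ ψ
Sat M ρ (φ ⇒' ψ)  = Sat M ρ φ → Sat M ρ ψ
Sat M ρ (∀' x φ)  = (d : D M) → Sat M (ρ [ x ↦ d ]) φ
Sat M ρ (∃' x φ)  = Σ (D M) λ d → Sat M (ρ [ x ↦ d ]) φ

_,_⊨_[_] : (M : Structure) → D M → Fm → Var → Set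
M , a ⊨ φ [ x ] = (ρ : Var → D M) → ρ x ≡ a → Sat M ρ φ

data IFm : Set where
  p    : ℕ → IFm
  ⊥ᵢ   : IFm
  _∧ᵢ_ : IFm → IFm → IFm
  _∨ᵢ_ : IFm → IFm → IFm
  _→ᵢ_ : IFm → IFm → IFm

-- ST(i,x); the bound variable of an implication clause is y = x+1, which is
-- fresh (all variables introduced inside ST(i,x) are > x, and x is the only
-- free variable).
ST : IFm → Var → Fm
ST (p n) x     = P' n x
ST ⊥ᵢ x        = ¬' (x ≐ x)
ST (i ∧ᵢ j) x  = ST i x ∧' ST j x
ST (i ∨ᵢ j) x  = ST i x ∨' ST j x
ST (i →ᵢ j) x  = ∀' (suc x) (R' x (suc x) ⇒' (ST i (suc x) ⇒' ST j (suc x)))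

data Side : Set where
  sM sN : Side

pick : Structure → Structure → Side → Structure
pick M N sM = M
pick M N sN = N

-- A tuple of length m+1 is
-- represented as its first m entries (a Vec) together with its last entry.
TupleRel : Structure → Structure → Set₁
TupleRel M N = (α β : Side) (m : ℕ) →
  Vec (D (pick M N α)) m → D (pick M N α) →
  Vec (D (pick M N β)) m → D (pick M N β) → Set

record IsAsimulation (l : ℕ) (Σ' : Sig) (M : Structure) (a : D M)
                     (N : Structure) (b : D N) (A : TupleRel M N) : Set where
  field
    base  : A sM sN 0 [] a [] b
    unary : ∀ (α β : Side) (m : ℕ)
              (as : Vec (D (pick M N α)) m) (a' : D (pick M N α))
              (bs : Vec (D (pick M N β)) m) (b' : D (pick M N β)) →
              A α β m as a' bs b' →
              ∀ n → Σ' n → Pr (pick M N α) n a' → Pr (pick M N β) n b'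
    back  : ∀ (α β : Side) (m : ℕ)
              (as : Vec (D (pick M N α)) m) (a' : D (pick M N α))
              (bs : Vec (D (pick M N β)) m) (b' : D (pick M N β)) →
              A α β m as a' bs b' →
              (b'' : D (pick M N β)) → Rel (pick M N β) b' b'' → m < l →
              Σ (D (pick M N α)) λ a'' →
                Rel (pick M N α) a' a'' ×
                A β α (suc m) (bs ∷ʳ b') b'' (as ∷ʳ a') a'' ×
                A α β (suc m) (as ∷ʳ a') a'' (bs ∷ʳ b') b''

-- ST(i,x) defines in every model exactly the Kripke forcing of i, reading R as the
-- accessibility relation.  Forcing is then preserved along A by induction on i:
-- atoms by clause (1); for i → j at b', a successor b'' of b' is matched by clause
-- (2) with a successor a'' of a' related in BOTH directions, so i transfers from
-- b'' to a'' and j back from a'' to b''.  Each implication consumes one unit of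
-- degree and lengthens the tuples by one, which is what m + r(φ) ≤ l accounts for.
module Submission where

open import Defs
open import Data.Nat using (ℕ; _+_; _≤_; _⊔_; suc; _≟_)
open import Data.Nat.Properties using (+-suc; ≤-trans; +-monoʳ-≤; m≤m⊔n; m≤n⊔m; m+n≤o⇒m≤o; 1+n≢n)
open import Data.Vec using (Vec)
open import Data.Product using (_×_; _,_)
open import Data.Sum using (_⊎_; inj₁; inj₂)
open import Data.Empty using (⊥; ⊥-elim)
open import Relation.Nullary using (yes; no)
open import Relation.Binary.PropositionalEquality using (_≡_; _≢_; refl; sym; trans; subst; subst₂)

infix 3 _,_⊩_

_,_⊩_ : (M : Structure) → D M → IFm → Set
M , d ⊩ p n     = Pr M n d
M , d ⊩ ⊥ᵢ      = ⊥
M , d ⊩ i ∧ᵢ j  = (M , d ⊩ i) × (M , d ⊩ j)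
M , d ⊩ i ∨ᵢ j  = (M , d ⊩ i) ⊎ (M , d ⊩ j)
M , d ⊩ i →ᵢ j  = (e : D M) → Rel M d e → M , e ⊩ i → M , e ⊩ j

[↦]-self : {X : Set} (ρ : Var → X) (y : Var) (e : X) → (ρ [ y ↦ e ]) y ≡ e
[↦]-self ρ y e with y ≟ y
... | yes _   = refl
... | no y≢y = ⊥-elim (y≢y refl)

[↦]-other : {X : Set} (ρ : Var → X) {x y : Var} (e : X) → x ≢ y → (ρ [ y ↦ e ]) x ≡ ρ x
[↦]-other ρ {x} {y} e x≢y with x ≟ y
... | yes x≡y = ⊥-elim (x≢y x≡y)
... | no _    = refl

[suc↦]-keeps : {X : Set} (ρ : Var → X) (x : Var) (e : X) → (ρ [ suc x ↦ e ]) x ≡ ρ x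
[suc↦]-keeps ρ x e = [↦]-other ρ e (λ x≡1+x → 1+n≢n (sym x≡1+x))

Sat-ST⇒⊩ : (M : Structure) (i : IFm) (x : Var) (ρ : Var → D M) {d : D M} →
  ρ x ≡ d → Sat M ρ (ST i x) → M , d ⊩ i
⊩⇒Sat-ST : (M : Structure) (i : IFm) (x : Var) (ρ : Var → D M) {d : D M} →
  ρ x ≡ d → M , d ⊩ i → Sat M ρ (ST i x)

Sat-ST⇒⊩ M (p n)    x ρ ρx≡d s         = subst (Pr M n) ρx≡d s
Sat-ST⇒⊩ M ⊥ᵢ       x ρ ρx≡d s         = s refl
Sat-ST⇒⊩ M (i ∧ᵢ j) x ρ ρx≡d (s , t)   = Sat-ST⇒⊩ M i x ρ ρx≡d s , Sat-ST⇒⊩ M j x ρ ρx≡d t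
Sat-ST⇒⊩ M (i ∨ᵢ j) x ρ ρx≡d (inj₁ s)  = inj₁ (Sat-ST⇒⊩ M i x ρ ρx≡d s)
Sat-ST⇒⊩ M (i ∨ᵢ j) x ρ ρx≡d (inj₂ t)  = inj₂ (Sat-ST⇒⊩ M j x ρ ρx≡d t)
Sat-ST⇒⊩ M (i →ᵢ j) x ρ ρx≡d s e de e⊩i =
  Sat-ST⇒⊩ M j (suc x) ρ' ρ'y≡e (s e ρ'x-R-ρ'y (⊩⇒Sat-ST M i (suc x) ρ' ρ'y≡e e⊩i))
  where
  ρ' = ρ [ suc x ↦ e ]
  ρ'y≡e = [↦]-self ρ (suc x) e
  ρ'x-R-ρ'y : Rel M (ρ' x) (ρ' (suc x))
  ρ'x-R-ρ'y = subst₂ (Rel M) (sym (trans ([suc↦]-keeps ρ x e) ρx≡d)) (sym ρ'y≡e) de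

⊩⇒Sat-ST M (p n)    x ρ ρx≡d s         = subst (Pr M n) (sym ρx≡d) s
⊩⇒Sat-ST M ⊥ᵢ       x ρ ρx≡d ()
⊩⇒Sat-ST M (i ∧ᵢ j) x ρ ρx≡d (s , t)   = ⊩⇒Sat-ST M i x ρ ρx≡d s , ⊩⇒Sat-ST M j x ρ ρx≡d t
⊩⇒Sat-ST M (i ∨ᵢ j) x ρ ρx≡d (inj₁ s)  = inj₁ (⊩⇒Sat-ST M i x ρ ρx≡d s)
⊩⇒Sat-ST M (i ∨ᵢ j) x ρ ρx≡d (inj₂ t)  = inj₂ (⊩⇒Sat-ST M j x ρ ρx≡d t)
⊩⇒Sat-ST M (i →ᵢ j) x ρ ρx≡d d⊩i→j e ρx-R-e s =
  ⊩⇒Sat-ST M j (suc x) ρ' ρ'y≡e (d⊩i→j e d-R-e (Sat-ST⇒⊩ M i (suc x) ρ' ρ'y≡e s))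
  where
  ρ' = ρ [ suc x ↦ e ]
  ρ'y≡e = [↦]-self ρ (suc x) e
  d-R-e = subst₂ (Rel M) (trans ([suc↦]-keeps ρ x e) ρx≡d) ρ'y≡e ρx-R-e

+⊔≤⇒+ˡ≤ : ∀ m {n o l : ℕ} → m + (n ⊔ o) ≤ l → m + n ≤ l
+⊔≤⇒+ˡ≤ m {n} {o} = ≤-trans (+-monoʳ-≤ m (m≤m⊔n n o))

+⊔≤⇒+ʳ≤ : ∀ m {n o l : ℕ} → m + (n ⊔ o) ≤ l → m + o ≤ l
+⊔≤⇒+ʳ≤ m {n} {o} = ≤-trans (+-monoʳ-≤ m (m≤n⊔m n o))

+suc≤⇒suc+≤ : ∀ m {n l : ℕ} → m + suc n ≤ l → suc m + n ≤ l
+suc≤⇒suc+≤ m {n} {l} = subst (_≤ l) (+-suc m n)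

module _ {Σ' : Sig} {M N : Structure} {a : D M} {b : D N} {l : ℕ} {A : TupleRel M N}
         (asim : IsAsimulation l Σ' M a N b A) where
  open IsAsimulation asim

  asimulation-preserves-⊩ : (i : IFm) (x : Var) → SigIncl (ST i x) Σ' →
    (α β : Side) (m : ℕ)
    (as : Vec (D (pick M N α)) m) (a' : D (pick M N α))
    (bs : Vec (D (pick M N β)) m) (b' : D (pick M N β)) →
    A α β m as a' bs b' → m + r (ST i x) ≤ l →
    pick M N α , a' ⊩ i → pick M N β , b' ⊩ i
  asimulation-preserves-⊩ (p n) x incl α β m as a' bs b' related _ a'⊩ =
    unary α β m as a' bs b' related n (incl n here) a'⊩
  asimulation-preserves-⊩ ⊥ᵢ x incl α β m as a' bs b' related _ ()
  asimulation-preserves-⊩ (i ∧ᵢ j) x incl α β m as a' bs b' related m+k≤l (a'⊩i , a'⊩j) =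
      asimulation-preserves-⊩ i x (λ n o → incl n (∧-l o)) α β m as a' bs b' related
        (+⊔≤⇒+ˡ≤ m m+k≤l) a'⊩i
    , asimulation-preserves-⊩ j x (λ n o → incl n (∧-r o)) α β m as a' bs b' related
        (+⊔≤⇒+ʳ≤ m m+k≤l) a'⊩j
  asimulation-preserves-⊩ (i ∨ᵢ j) x incl α β m as a' bs b' related m+k≤l (inj₁ a'⊩i) =
    inj₁ (asimulation-preserves-⊩ i x (λ n o → incl n (∨-l o)) α β m as a' bs b' related
      (+⊔≤⇒+ˡ≤ m m+k≤l) a'⊩i)
  asimulation-preserves-⊩ (i ∨ᵢ j) x incl α β m as a' bs b' related m+k≤l (inj₂ a'⊩j) =
    inj₂ (asimulation-preserves-⊩ j x (λ n o → incl n (∨-r o)) α β m as a' bs b' related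
      (+⊔≤⇒+ʳ≤ m m+k≤l) a'⊩j)
  asimulation-preserves-⊩ (i →ᵢ j) x incl α β m as a' bs b' related m+k≤l
                          a'⊩i→j b'' b'Rb'' b''⊩i =
    let sm+k'≤l = +suc≤⇒suc+≤ m m+k≤l
        (a'' , a'Ra'' , b''-A-a'' , a''-A-b'') =
          back α β m as a' bs b' related b'' b'Rb'' (m+n≤o⇒m≤o (suc m) sm+k'≤l)
        a''⊩i = asimulation-preserves-⊩ i (suc x) (λ n o → incl n (∀-in (⇒-r (⇒-l o))))
                  β α (suc m) _ b'' _ a'' b''-A-a'' (+⊔≤⇒+ˡ≤ (suc m) sm+k'≤l) b''⊩i
    in asimulation-preserves-⊩ j (suc x) (λ n o → incl n (∀-in (⇒-r (⇒-r o))))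
         α β (suc m) _ a'' _ b'' a''-A-b'' (+⊔≤⇒+ʳ≤ (suc m) sm+k'≤l) (a'⊩i→j a'' a'Ra'' a''⊩i)

lemma1 : (i : IFm) (x : Var) (Σ' : Sig) → SigIncl (ST i x) Σ' →
    (M N : Structure) (a : D M) (b : D N) (l : ℕ) (A : TupleRel M N) →
    IsAsimulation l Σ' M a N b A →
    (α β : Side) (m : ℕ)
    (as : Vec (D (pick M N α)) m) (a' : D (pick M N α))
    (bs : Vec (D (pick M N β)) m) (b' : D (pick M N β)) →
    A α β m as a' bs b' → m + r (ST i x) ≤ l →
    pick M N α , a' ⊨ ST i x [ x ] → pick M N β , b' ⊨ ST i x [ x ]
lemma1 i x Σ' incl M N a b l A asim α β m as a' bs b' related m+k≤l a'⊨ ρ ρx≡b' =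
  ⊩⇒Sat-ST (pick M N β) i x ρ ρx≡b'
    (asimulation-preserves-⊩ asim i x incl α β m as a' bs b' related m+k≤l a'⊩i)
  where
  a'⊩i : pick M N α , a' ⊩ i
  a'⊩i = Sat-ST⇒⊩ (pick M N α) i x (λ _ → a') refl (a'⊨ (λ _ → a') refl)
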